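{- Let $q$ be a prime power. Any identifying code of the adjacency graph of a generalized quadrangle $\mathrm{GQ}(q,q)$ has size at least $3q-4$.
   Context: A generalized quadrangle $\mathrm{GQ}(s,t)$ is an incidence structure of points and lines such that every line contains $s+1$ points, every point lies on $t+1$ lines, and for every point $P$ not on a line $L$ there is exactly one line through $P$ meeting $L$. Its adjacency graph has the points as vertices, two distinct points adjacent if they lie on a common line. An identifying code of a graph is a set $C$ of vertices such that $N[u]\cap C\neq\emptyset$ for every vertex $u$ and $N[u]\cap C\neq N[v]\cap C$ for all distinct $u,v$, where $N[u]$ is the closed neighbourhood of $u$. -}

module Defs where

open import Data.Nat using (ℕ; suc; _^_; _<_)
open import Data.Nat.Primality using (Prime)
open import Data.Fin using (Fin)
open import Data.Fin.Subset using (Subset; _∈_; _∉_; ∣_∣)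
open import Data.Vec using (tabulate; lookup)
open import Data.Product using (Σ; ∃; ∃-syntax; _×_)
open import Data.Sum using (_⊎_)
open import Relation.Nullary using (¬_)
open import Relation.Binary.PropositionalEquality using (_≡_; _≢_)

IsPrimePower : ℕ → Set
IsPrimePower q = Σ ℕ λ p → Σ ℕ λ k → Prime p × q ≡ p ^ suc k

record GQ (s t : ℕ) : Set where
  field
    nP nL : ℕ
    line : Fin nL → Subset nP
    nonempty : 0 < nP
    lineSize : ∀ L → ∣ line L ∣ ≡ suc s
    pointDeg : ∀ P → ∣ tabulate (λ L → lookup (line L) P) ∣ ≡ suc t
    partialLinear : ∀ P Q L M → P ≢ Q → P ∈ line L → Q ∈ line L →
                    P ∈ line M → Q ∈ line M → L ≡ M
    gqAxiom : ∀ P L → P ∉ line L →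
              Σ (Fin nL) λ M → (P ∈ line M × ∃[ R ] (R ∈ line M × R ∈ line L))
                × (∀ M' → P ∈ line M' → ∃[ R ] (R ∈ line M' × R ∈ line L) → M' ≡ M)

module _ {s t : ℕ} (G : GQ s t) where
  open GQ G

  InClosedNbhd : Fin nP → Fin nP → Set
  InClosedNbhd u v = v ≡ u ⊎ ∃[ L ] (u ∈ line L × v ∈ line L)

  IsIdentifyingCode : Subset nP → Set
  IsIdentifyingCode C =
    (∀ u → ∃[ c ] (c ∈ C × InClosedNbhd u c)) ×
    (∀ u v → u ≢ v →
      ¬ (∀ c → c ∈ C → ((InClosedNbhd u c → InClosedNbhd v c) × (InClosedNbhd v c → InClosedNbhd u c))))

-- Write d(u) for the number of codewords in the closed neighbourhood N[u]. Every point has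
-- d(u) ≥ 1, and since C separates points, a point with d(u) = 1 is determined by its codeword
-- and a point with d(u) = 2 by its pair of codewords; so #{d = 1} ≤ |C| and
-- 2·#{d = 2} ≤ |C|² − |C|. Charging 3 to every point therefore gives
--   3v ≤ Σ d + 2·#{d = 1} + #{d = 2} ≤ |C|·k + 2|C| + (|C|² − |C|)/2,
-- since Σ d = Σ_{c ∈ C} |N[c]| and every closed neighbourhood of GQ(q,q) has k = q² + q + 1
-- points. A line together with its transversals already carries v ≥ (q+1)(q²+1) points, and
-- for |C| ≤ 3q − 5 the inequality fails.

module Submission where

open import Defs
open import Data.Nat using (ℕ; _≤_; _*_; _∸_)
open import Data.Fin.Subset using (Subset; ∣_∣)
open import Data.Nat using (zero; suc; _+_; _<_; z≤n; s≤s; _≟_; _≤?_)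
open import Data.Nat.Properties
open import Data.Bool using (Bool; true; false; if_then_else_) renaming (_≟_ to _≟ᵇ_)
open import Data.Fin using (Fin; zero; suc; fromℕ<)
open import Data.Fin.Properties using (any?)
  renaming (_≟_ to _≟ᶠ_; suc-injective to suc-injectiveᶠ; 0≢1+n to 0≢1+nᶠ)
open import Data.Fin.Subset using (_∈_; _∉_; inside)
open import Data.Fin.Subset.Properties using (_∈?_)
open import Data.Vec using (lookup; tabulate)
open import Data.Product using (∃-syntax; _×_; _,_; proj₁; proj₂)
open import Data.Sum using (_⊎_; inj₁; inj₂)
open import Data.Unit using (tt)
open import Data.Empty using (⊥-elim)
open import Function using (_∘_)
open import Relation.Nullary using (¬_; Dec; yes; no; does; ¬?)
open import Relation.Nullary.Decidable using (_×-dec_; _⊎-dec_)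
open import Relation.Binary.PropositionalEquality
open import Algebra.Properties.CommutativeSemigroup +-commutativeSemigroup using (x∙yz≈y∙xz)
open import Algebra.Properties.Semiring.Sum +-*-semiring
  using (sum-syntax; sum-cong-≗; ∑-distrib-+; ∑-comm; *-distribˡ-sum; *-distribʳ-sum)
open import Data.Nat.Tactic.RingSolver using (solve)
open import Data.List using ([]; _∷_)

-- Defined through `does`, so that 𝟙 commutes definitionally with `map′`:
-- 𝟙 (suc i ≟ᶠ suc j) reduces to 𝟙 (i ≟ᶠ j).
𝟙 : ∀ {a} {P : Set a} → Dec P → ℕ
𝟙 p = if does p then 1 else 0

module _ {a} {P : Set a} where

  𝟙-yes : P → (p : Dec P) → 𝟙 p ≡ 1
  𝟙-yes _ (yes _) = refl
  𝟙-yes x (no ¬x) = ⊥-elim (¬x x)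

  𝟙-no : ¬ P → (p : Dec P) → 𝟙 p ≡ 0
  𝟙-no ¬x (yes x) = ⊥-elim (¬x x)
  𝟙-no _  (no _)  = refl

  𝟙*𝟙 : (p : Dec P) → 𝟙 p * 𝟙 p ≡ 𝟙 p
  𝟙*𝟙 (yes _) = refl
  𝟙*𝟙 (no _)  = refl

  𝟙+𝟙¬ : (p : Dec P) → 𝟙 p + 𝟙 (¬? p) ≡ 1
  𝟙+𝟙¬ (yes _) = refl
  𝟙+𝟙¬ (no _)  = refl

𝟙-mono : ∀ {a b} {P : Set a} {Q : Set b} → (P → Q) → (p : Dec P) (q : Dec Q) → 𝟙 p ≤ 𝟙 q
𝟙-mono P→Q (yes x) q = ≤-reflexive (sym (𝟙-yes (P→Q x) q))
𝟙-mono _   (no _)  _ = z≤n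

𝟙*-cong : ∀ {a} {P : Set a} {m k} → (P → m ≡ k) → (p : Dec P) → 𝟙 p * m ≡ 𝟙 p * k
𝟙*-cong P⇒m≡k (yes x) = cong (1 *_) (P⇒m≡k x)
𝟙*-cong _      (no _)  = refl

𝟙*-≤ : ∀ {a} {P : Set a} {m k} → (P → k ≤ m) → (p : Dec P) → 𝟙 p * k ≤ m
𝟙*-≤ {k = k} P⇒k≤m (yes x) = subst (_≤ _) (sym (+-identityʳ k)) (P⇒k≤m x)
𝟙*-≤         _      (no _)  = z≤n

module _ {a b} {P : Set a} {Q : Set b} where

  𝟙-×-dec : (p : Dec P) (q : Dec Q) → 𝟙 (p ×-dec q) ≡ 𝟙 p * 𝟙 q
  𝟙-×-dec (yes _) (yes _) = refl
  𝟙-×-dec (yes _) (no _)  = refl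
  𝟙-×-dec (no _)  _       = refl

  𝟙-split : (p : Dec P) (q : Dec Q) → 𝟙 p ≡ 𝟙 (p ×-dec q) + 𝟙 (p ×-dec ¬? q)
  𝟙-split (yes _) (yes _) = refl
  𝟙-split (yes _) (no _)  = refl
  𝟙-split (no _)  _       = refl

∑-mono : ∀ n {f g : Fin n → ℕ} → (∀ i → f i ≤ g i) → ∑[ i < n ] f i ≤ ∑[ i < n ] g i
∑-mono zero    f≤g = z≤n
∑-mono (suc n) f≤g = +-mono-≤ (f≤g zero) (∑-mono n (λ i → f≤g (suc i)))

∑-const : ∀ n k → ∑[ i < n ] k ≡ n * k
∑-const zero    k = refl
∑-const (suc n) k = cong (k +_) (∑-const n k)

∑-pick : ∀ n (f : Fin n → ℕ) a → ∑[ i < n ] f i ≡ f a + ∑[ i < n ] (f i * 𝟙 (¬? (a ≟ᶠ i)))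
∑-pick (suc n) f zero = cong (f zero +_) (begin
  ∑[ i < n ] f (suc i)                     ≡⟨ sum-cong-≗ (λ i → sym (*-identityʳ (f (suc i)))) ⟩
  ∑[ i < n ] (f (suc i) * 1)               ≡⟨ cong (_+ ∑[ i < n ] (f (suc i) * 1)) (sym (*-zeroʳ (f zero))) ⟩
  f zero * 0 + ∑[ i < n ] (f (suc i) * 1)  ∎)
  where open ≡-Reasoning
∑-pick (suc n) f (suc a) = begin
  f zero + ∑[ i < n ] f (suc i)  ≡⟨ cong (f zero +_) (∑-pick n (λ i → f (suc i)) a) ⟩
  f zero + (f (suc a) + rest)    ≡⟨ x∙yz≈y∙xz (f zero) (f (suc a)) rest ⟩
  f (suc a) + (f zero + rest)    ≡⟨ cong (λ x → f (suc a) + (x + rest)) (sym (*-identityʳ (f zero))) ⟩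
  f (suc a) + (f zero * 1 + rest) ∎
  where open ≡-Reasoning
        rest = ∑[ i < n ] (f (suc i) * 𝟙 (¬? (a ≟ᶠ i)))

term≤∑ : ∀ n (f : Fin n → ℕ) a → f a ≤ ∑[ i < n ] f i
term≤∑ n f a = ≤-trans (m≤m+n (f a) _) (≤-reflexive (sym (∑-pick n f a)))

∑-unique-𝟙 : ∀ {p q} n {P : Fin n → Set p} (P? : ∀ i → Dec (P i)) {Q : Set q} (Q? : Dec Q) →
             (∀ i → P i → Q) → (∀ i j → P i → P j → i ≡ j) → ∑[ i < n ] 𝟙 (P? i) ≤ 𝟙 Q?
∑-unique-𝟙 zero    P? Q? P⇒Q unique = z≤n
∑-unique-𝟙 (suc n) {P} P? Q? P⇒Q unique with P? zero
... | yes P0 = ≤-reflexive (begin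
  1 + ∑[ i < n ] 𝟙 (P? (suc i))  ≡⟨ cong suc (sum-cong-≗ (λ i → 𝟙-no (¬Psuc i) (P? (suc i)))) ⟩
  1 + ∑[ i < n ] 0              ≡⟨ cong suc (∑-const n 0) ⟩
  1 + n * 0                     ≡⟨ cong suc (*-zeroʳ n) ⟩
  1                             ≡⟨ sym (𝟙-yes (P⇒Q zero P0) Q?) ⟩
  𝟙 Q?                          ∎)
  where open ≡-Reasoning
        ¬Psuc : ∀ i → ¬ P (suc i)
        ¬Psuc i Pi = 0≢1+nᶠ (unique zero (suc i) P0 Pi)
... | no _ = ∑-unique-𝟙 n (λ i → P? (suc i)) Q? (λ i → P⇒Q (suc i))
               (λ i j Pi Pj → suc-injectiveᶠ (unique (suc i) (suc j) Pi Pj))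

∑-𝟙-pick : ∀ n {p} {P : Fin n → Set p} (P? : ∀ i → Dec (P i)) a →
           ∑[ i < n ] 𝟙 (P? i) ≡ 𝟙 (P? a) + ∑[ i < n ] 𝟙 (P? i ×-dec ¬? (a ≟ᶠ i))
∑-𝟙-pick n P? a = trans (∑-pick n (λ i → 𝟙 (P? i)) a)
  (cong (𝟙 (P? a) +_) (sum-cong-≗ (λ i → sym (𝟙-×-dec (P? i) (¬? (a ≟ᶠ i))))))

∑-𝟙≥1 : ∀ n {p} {P : Fin n → Set p} (P? : ∀ i → Dec (P i)) {a} → P a → 1 ≤ ∑[ i < n ] 𝟙 (P? i)
∑-𝟙≥1 n P? {a} Pa = subst (_≤ _) (𝟙-yes Pa (P? a)) (term≤∑ n (λ i → 𝟙 (P? i)) a)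

∑-𝟙≥2 : ∀ n {p} {P : Fin n → Set p} (P? : ∀ i → Dec (P i)) {a b} →
        a ≢ b → P a → P b → 2 ≤ ∑[ i < n ] 𝟙 (P? i)
∑-𝟙≥2 n P? {a} a≢b Pa Pb rewrite ∑-𝟙-pick n P? a | 𝟙-yes Pa (P? a) =
  +-monoʳ-≤ 1 (∑-𝟙≥1 n (λ i → P? i ×-dec ¬? (a ≟ᶠ i)) (Pb , a≢b))

∑-𝟙≥3 : ∀ n {p} {P : Fin n → Set p} (P? : ∀ i → Dec (P i)) {a b c} →
        a ≢ b → a ≢ c → b ≢ c → P a → P b → P c → 3 ≤ ∑[ i < n ] 𝟙 (P? i)
∑-𝟙≥3 n P? {a} a≢b a≢c b≢c Pa Pb Pc rewrite ∑-𝟙-pick n P? a | 𝟙-yes Pa (P? a) =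
  +-monoʳ-≤ 1 (∑-𝟙≥2 n (λ i → P? i ×-dec ¬? (a ≟ᶠ i)) b≢c (Pb , a≢b) (Pc , a≢c))

∑-𝟙-split : ∀ n {p q} {P : Fin n → Set p} {Q : Fin n → Set q}
            (P? : ∀ i → Dec (P i)) (Q? : ∀ i → Dec (Q i)) →
            ∑[ i < n ] 𝟙 (P? i) ≡ ∑[ i < n ] 𝟙 (P? i ×-dec Q? i) + ∑[ i < n ] 𝟙 (P? i ×-dec ¬? (Q? i))
∑-𝟙-split n P? Q? = trans (sum-cong-≗ (λ i → 𝟙-split (P? i) (Q? i)))
                          (∑-distrib-+ (λ i → 𝟙 (P? i ×-dec Q? i)) (λ i → 𝟙 (P? i ×-dec ¬? (Q? i))))

∑-𝟙-all-but-one : ∀ n {p q} {P : Fin n → Set p} {Q : Fin n → Set q}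
                  (P? : ∀ i → Dec (P i)) (Q? : ∀ i → Dec (Q i)) {k} →
                  ∑[ i < n ] 𝟙 (P? i) ≡ suc k → ∑[ i < n ] 𝟙 (P? i ×-dec Q? i) ≤ 1 →
                  k ≤ ∑[ i < n ] 𝟙 (P? i ×-dec ¬? (Q? i))
∑-𝟙-all-but-one n P? Q? ∑≡1+k PQ≤1 = +-cancelˡ-≤ 1 _ _ (begin
  suc _                                                  ≡⟨ sym ∑≡1+k ⟩
  ∑[ i < n ] 𝟙 (P? i)                                    ≡⟨ ∑-𝟙-split n P? Q? ⟩
  ∑[ i < n ] 𝟙 (P? i ×-dec Q? i) + ∑[ i < n ] 𝟙 (P? i ×-dec ¬? (Q? i)) ≤⟨ +-monoˡ-≤ _ PQ≤1 ⟩
  1 + ∑[ i < n ] 𝟙 (P? i ×-dec ¬? (Q? i))                 ∎)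
  where open ≤-Reasoning

nonzero-∑⇒Fin : ∀ n (f : Fin n → ℕ) {k} → ∑[ i < n ] f i ≡ suc k → Fin n
nonzero-∑⇒Fin (suc n) _ _ = zero

module _ n {p} {P : Fin n → Set p} (P? : ∀ i → Dec (P i)) where

  ∑-𝟙-distinct-pairs : ∑[ i < n ] ∑[ j < n ] 𝟙 (P? i ×-dec (P? j ×-dec ¬? (i ≟ᶠ j))) + ∑[ i < n ] 𝟙 (P? i)
                       ≡ ∑[ i < n ] 𝟙 (P? i) * ∑[ i < n ] 𝟙 (P? i)
  ∑-𝟙-distinct-pairs = sym (begin
    #P * #P                                       ≡⟨ *-distribʳ-sum #P (λ i → 𝟙 (P? i)) ⟩
    ∑[ i < n ] (𝟙 (P? i) * #P)                    ≡⟨ sum-cong-≗ row ⟩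
    ∑[ i < n ] (𝟙 (P? i) + pairsFrom i)           ≡⟨ ∑-distrib-+ (λ i → 𝟙 (P? i)) pairsFrom ⟩
    #P + ∑[ i < n ] pairsFrom i                   ≡⟨ +-comm #P _ ⟩
    ∑[ i < n ] pairsFrom i + #P                   ∎)
    where
    open ≡-Reasoning
    #P = ∑[ i < n ] 𝟙 (P? i)
    pairsFrom : Fin n → ℕ
    pairsFrom i = ∑[ j < n ] 𝟙 (P? i ×-dec (P? j ×-dec ¬? (i ≟ᶠ j)))
    row : ∀ i → 𝟙 (P? i) * #P ≡ 𝟙 (P? i) + pairsFrom i
    row i = begin
      𝟙 (P? i) * #P                                                 ≡⟨ cong (𝟙 (P? i) *_) (∑-𝟙-pick n P? i) ⟩
      𝟙 (P? i) * (𝟙 (P? i) + ∑[ j < n ] 𝟙 (P? j ×-dec ¬? (i ≟ᶠ j))) ≡⟨ *-distribˡ-+ (𝟙 (P? i)) _ _ ⟩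
      𝟙 (P? i) * 𝟙 (P? i) + 𝟙 (P? i) * ∑[ j < n ] 𝟙 (P? j ×-dec ¬? (i ≟ᶠ j))
        ≡⟨ cong₂ _+_ (𝟙*𝟙 (P? i)) (*-distribˡ-sum (𝟙 (P? i)) (λ j → 𝟙 (P? j ×-dec ¬? (i ≟ᶠ j)))) ⟩
      𝟙 (P? i) + ∑[ j < n ] (𝟙 (P? i) * 𝟙 (P? j ×-dec ¬? (i ≟ᶠ j)))
        ≡⟨ cong (𝟙 (P? i) +_) (sum-cong-≗ (λ j → sym (𝟙-×-dec (P? i) (P? j ×-dec ¬? (i ≟ᶠ j))))) ⟩
      𝟙 (P? i) + pairsFrom i                                        ∎

∑-𝟙≡ : ∀ n (a : Fin n) → ∑[ i < n ] 𝟙 (a ≟ᶠ i) ≡ 1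
∑-𝟙≡ (suc n) zero    = cong suc (trans (∑-const n 0) (*-zeroʳ n))
∑-𝟙≡ (suc n) (suc a) = ∑-𝟙≡ n a

-- Vec's constructors stay local: overloaded with List's, they make `solve` very slow to elaborate.
module _ where
  open import Data.Vec using ([]; _∷_)

  ∣p∣≡∑𝟙∈ : ∀ {n} (p : Subset n) → ∣ p ∣ ≡ ∑[ i < n ] 𝟙 (i ∈? p)
  ∣p∣≡∑𝟙∈ []          = refl
  ∣p∣≡∑𝟙∈ (true ∷ p)  = cong suc (∣p∣≡∑𝟙∈ p)
  ∣p∣≡∑𝟙∈ (false ∷ p) = ∣p∣≡∑𝟙∈ p

  ∣tabulate∣≡∑𝟙 : ∀ m (g : Fin m → Bool) → ∣ tabulate g ∣ ≡ ∑[ i < m ] 𝟙 (g i ≟ᵇ inside)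
  ∣tabulate∣≡∑𝟙 zero    g = refl
  ∣tabulate∣≡∑𝟙 (suc m) g with g zero
  ... | true  = cong suc (∣tabulate∣≡∑𝟙 m (λ i → g (suc i)))
  ... | false = ∣tabulate∣≡∑𝟙 m (λ i → g (suc i))

  𝟙∈≡𝟙lookup : ∀ {n} (x : Fin n) (p : Subset n) → 𝟙 (x ∈? p) ≡ 𝟙 (lookup p x ≟ᵇ inside)
  𝟙∈≡𝟙lookup zero    (true ∷ p)  = refl
  𝟙∈≡𝟙lookup zero    (false ∷ p) = refl
  𝟙∈≡𝟙lookup (suc x) (_ ∷ p)     = 𝟙∈≡𝟙lookup x p

𝟙≟-weight : ∀ m k → m * 𝟙 (m ≟ k) ≡ k * 𝟙 (m ≟ k)
𝟙≟-weight m k = weigh (m ≟ k)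
  where
  weigh : (p : Dec (m ≡ k)) → m * 𝟙 p ≡ k * 𝟙 p
  weigh (yes refl) = refl
  weigh (no _)     = trans (*-zeroʳ m) (sym (*-zeroʳ k))

3≤m+2*[m≡1]+[m≡2] : ∀ {m} → 1 ≤ m → 3 ≤ m + 2 * 𝟙 (m ≟ 1) + 𝟙 (m ≟ 2)
3≤m+2*[m≡1]+[m≡2] {1}             _ = ≤-refl
3≤m+2*[m≡1]+[m≡2] {2}             _ = ≤-refl
3≤m+2*[m≡1]+[m≡2] {suc (suc (suc k))} _ = ≤-trans (m≤m+n 3 k) (≤-trans (m≤m+n _ _) (m≤m+n _ _))

double-counting-inequality : ∀ {n c K d n₁ n₂} → d ≤ c * K → 3 * n ≤ d + 2 * n₁ + n₂ → n₁ ≤ c →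
                             2 * n₂ + c ≤ c * c → 6 * n + c ≤ c * (2 * K + 4 + c)
double-counting-inequality {n} {c} {K} {d} {n₁} {n₂} d≤cK 3n≤ n₁≤c 2n₂+c≤c² = begin
  6 * n + c                          ≡⟨ solve (n ∷ c ∷ []) ⟩
  2 * (3 * n) + c                    ≤⟨ +-monoˡ-≤ c (*-monoʳ-≤ 2 3n≤) ⟩
  2 * (d + 2 * n₁ + n₂) + c          ≡⟨ solve (d ∷ n₁ ∷ n₂ ∷ c ∷ []) ⟩
  2 * d + 4 * n₁ + (2 * n₂ + c)      ≤⟨ +-mono-≤ (+-mono-≤ (*-monoʳ-≤ 2 d≤cK) (*-monoʳ-≤ 4 n₁≤c)) 2n₂+c≤c² ⟩
  2 * (c * K) + 4 * c + c * c        ≡⟨ solve (c ∷ K ∷ []) ⟩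
  c * (2 * K + 4 + c)                ∎
  where open ≤-Reasoning

-- A graph on Fin n given by its closed neighbourhoods (Adj u v means v ∈ N[u]), and an
-- identifying code C of it.
module IdentifyingCodeCounting
  {n : ℕ} (Adj : Fin n → Fin n → Set) (adj? : ∀ u v → Dec (Adj u v)) (C : Subset n)
  (dominating : ∀ u → ∃[ c ] (c ∈ C × Adj u c))
  (separating : ∀ u v → u ≢ v →
                ¬ (∀ c → c ∈ C → (Adj u c → Adj v c) × (Adj v c → Adj u c)))
  where

  CodeNbr : Fin n → Fin n → Set
  CodeNbr u c = c ∈ C × Adj u c

  codeNbr? : ∀ u c → Dec (CodeNbr u c)
  codeNbr? u c = (c ∈? C) ×-dec adj? u c

  CodePair : Fin n → Fin n → Fin n → Set
  CodePair u c c' = CodeNbr u c × CodeNbr u c' × c ≢ c'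

  codePair? : ∀ u c c' → Dec (CodePair u c c')
  codePair? u c c' = codeNbr? u c ×-dec (codeNbr? u c' ×-dec ¬? (c ≟ᶠ c'))

  codeDegree : Fin n → ℕ
  codeDegree u = ∑[ c < n ] 𝟙 (codeNbr? u c)

  #C : ℕ
  #C = ∑[ c < n ] 𝟙 (c ∈? C)

  #codeDegree : ℕ → ℕ
  #codeDegree k = ∑[ u < n ] 𝟙 (codeDegree u ≟ k)

  same-codeNbrs⇒≡ : ∀ u v → (∀ c → CodeNbr u c → Adj v c) → (∀ c → CodeNbr v c → Adj u c) → u ≡ v
  same-codeNbrs⇒≡ u v u⊆v v⊆u with u ≟ᶠ v
  ... | yes u≡v = u≡v
  ... | no  u≢v = ⊥-elim (separating u v u≢v
                    (λ c c∈C → (λ uc → u⊆v c (c∈C , uc)) , (λ vc → v⊆u c (c∈C , vc))))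

  codeDegree≥1 : ∀ u → 1 ≤ codeDegree u
  codeDegree≥1 u = ∑-𝟙≥1 n (codeNbr? u) (proj₂ (dominating u))

  codeDegree≡1⇒unique : ∀ {u c c'} → codeDegree u ≡ 1 → CodeNbr u c → CodeNbr u c' → c' ≡ c
  codeDegree≡1⇒unique {u} {c} {c'} d≡1 uc uc' with c' ≟ᶠ c
  ... | yes c'≡c = c'≡c
  ... | no  c'≢c = ⊥-elim (1+n≰n (subst (2 ≤_) d≡1 (∑-𝟙≥2 n (codeNbr? u) c'≢c uc' uc)))

  codeDegree≡2⇒cover : ∀ {u c c' c''} → codeDegree u ≡ 2 → c ≢ c' →
                        CodeNbr u c → CodeNbr u c' → CodeNbr u c'' → c'' ≡ c ⊎ c'' ≡ c'
  codeDegree≡2⇒cover {u} {c} {c'} {c''} d≡2 c≢c' uc uc' uc'' with c'' ≟ᶠ c | c'' ≟ᶠ c'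
  ... | yes c''≡c | _          = inj₁ c''≡c
  ... | no  _     | yes c''≡c' = inj₂ c''≡c'
  ... | no  c''≢c | no c''≢c'  = ⊥-elim (1+n≰n (subst (3 ≤_) d≡2
          (∑-𝟙≥3 n (codeNbr? u) c≢c' (c''≢c ∘ sym) (c''≢c' ∘ sym) uc uc' uc'')))

  codeDegree≡1-injective : ∀ c u v → CodeNbr u c × codeDegree u ≡ 1 →
                           CodeNbr v c × codeDegree v ≡ 1 → u ≡ v
  codeDegree≡1-injective c u v (uc , du) (vc , dv) = same-codeNbrs⇒≡ u v
    (λ c' uc' → subst (Adj v) (sym (codeDegree≡1⇒unique du uc uc')) (proj₂ vc))
    (λ c' vc' → subst (Adj u) (sym (codeDegree≡1⇒unique dv vc vc')) (proj₂ uc))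

  codeDegree≡2-injective : ∀ c c' u v → CodePair u c c' × codeDegree u ≡ 2 →
                           CodePair v c c' × codeDegree v ≡ 2 → u ≡ v
  codeDegree≡2-injective c c' u v ((uc , uc' , c≢c') , du) ((vc , vc' , _) , dv) = same-codeNbrs⇒≡ u v
    (λ c'' uc'' → covered v vc vc' (codeDegree≡2⇒cover du c≢c' uc uc' uc''))
    (λ c'' vc'' → covered u uc uc' (codeDegree≡2⇒cover dv c≢c' vc vc' vc''))
    where
    covered : ∀ w {c''} → CodeNbr w c → CodeNbr w c' → c'' ≡ c ⊎ c'' ≡ c' → Adj w c''
    covered w wc wc' (inj₁ refl) = proj₂ wc
    covered w wc wc' (inj₂ refl) = proj₂ wc'

  ∑codeDegree≤#C*K : ∀ K → (∀ c → ∑[ u < n ] 𝟙 (adj? u c) ≤ K) → ∑[ u < n ] codeDegree u ≤ #C * K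
  ∑codeDegree≤#C*K K nbhd≤K = begin
    ∑[ u < n ] ∑[ c < n ] 𝟙 (codeNbr? u c)          ≡⟨ ∑-comm (λ u c → 𝟙 (codeNbr? u c)) ⟩
    ∑[ c < n ] ∑[ u < n ] 𝟙 (codeNbr? u c)          ≡⟨ sum-cong-≗ factor ⟩
    ∑[ c < n ] (𝟙 (c ∈? C) * ∑[ u < n ] 𝟙 (adj? u c))
      ≤⟨ ∑-mono n (λ c → *-monoʳ-≤ (𝟙 (c ∈? C)) (nbhd≤K c)) ⟩
    ∑[ c < n ] (𝟙 (c ∈? C) * K)                     ≡⟨ *-distribʳ-sum K (λ c → 𝟙 (c ∈? C)) ⟨
    #C * K                                          ∎
    where
    open ≤-Reasoning
    factor : ∀ c → ∑[ u < n ] 𝟙 (codeNbr? u c) ≡ 𝟙 (c ∈? C) * ∑[ u < n ] 𝟙 (adj? u c)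
    factor c = trans (sum-cong-≗ (λ u → 𝟙-×-dec (c ∈? C) (adj? u c)))
                     (sym (*-distribˡ-sum (𝟙 (c ∈? C)) (λ u → 𝟙 (adj? u c))))

  #codeDegree1≤#C : #codeDegree 1 ≤ #C
  #codeDegree1≤#C = begin
    ∑[ u < n ] 𝟙 (codeDegree u ≟ 1)
      ≡⟨ sum-cong-≗ (λ u → trans (sym (*-identityˡ _)) (sym (𝟙≟-weight (codeDegree u) 1))) ⟩
    ∑[ u < n ] (codeDegree u * 𝟙 (codeDegree u ≟ 1))
      ≡⟨ sum-cong-≗ (λ u → *-distribʳ-sum (𝟙 (codeDegree u ≟ 1)) (λ c → 𝟙 (codeNbr? u c))) ⟩
    ∑[ u < n ] ∑[ c < n ] (𝟙 (codeNbr? u c) * 𝟙 (codeDegree u ≟ 1))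
      ≡⟨ ∑-comm (λ u c → 𝟙 (codeNbr? u c) * 𝟙 (codeDegree u ≟ 1)) ⟩
    ∑[ c < n ] ∑[ u < n ] (𝟙 (codeNbr? u c) * 𝟙 (codeDegree u ≟ 1))
      ≡⟨ sum-cong-≗ (λ c → sum-cong-≗ (λ u → sym (𝟙-×-dec (codeNbr? u c) (codeDegree u ≟ 1)))) ⟩
    ∑[ c < n ] ∑[ u < n ] 𝟙 (codeNbr? u c ×-dec (codeDegree u ≟ 1))
      ≤⟨ ∑-mono n (λ c → ∑-unique-𝟙 n (λ u → codeNbr? u c ×-dec (codeDegree u ≟ 1)) (c ∈? C)
                           (λ _ → proj₁ ∘ proj₁) (codeDegree≡1-injective c)) ⟩
    #C ∎
    where open ≤-Reasoning

  codePairs : Fin n → ℕ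
  codePairs u = ∑[ c < n ] ∑[ c' < n ] 𝟙 (codePair? u c c')

  codePairs-at-2 : ∀ u → codePairs u * 𝟙 (codeDegree u ≟ 2) ≡ 2 * 𝟙 (codeDegree u ≟ 2)
  codePairs-at-2 u = at-2 (codeDegree u ≟ 2)
    where
    at-2 : (p : Dec (codeDegree u ≡ 2)) → codePairs u * 𝟙 p ≡ 2 * 𝟙 p
    at-2 (yes d≡2) = cong (_* 1) (+-cancelʳ-≡ 2 (codePairs u) 2
      (subst (λ d → codePairs u + d ≡ d * d) d≡2 (∑-𝟙-distinct-pairs n (codeNbr? u))))
    at-2 (no _)    = *-zeroʳ (codePairs u)

  2*#codeDegree2≡∑codePairs : 2 * #codeDegree 2 ≡
                              ∑[ c < n ] ∑[ c' < n ] ∑[ u < n ] 𝟙 (codePair? u c c' ×-dec (codeDegree u ≟ 2))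
  2*#codeDegree2≡∑codePairs = begin
    2 * ∑[ u < n ] e₂ u                                                   ≡⟨ *-distribˡ-sum 2 e₂ ⟩
    ∑[ u < n ] (2 * e₂ u)                                                 ≡⟨ sum-cong-≗ (λ u → sym (codePairs-at-2 u)) ⟩
    ∑[ u < n ] (codePairs u * e₂ u)                                       ≡⟨ sum-cong-≗ spread ⟩
    ∑[ u < n ] ∑[ c < n ] ∑[ c' < n ] 𝟙 (codePair? u c c' ×-dec (codeDegree u ≟ 2))
      ≡⟨ ∑-comm (λ u c → ∑[ c' < n ] 𝟙 (codePair? u c c' ×-dec (codeDegree u ≟ 2))) ⟩
    ∑[ c < n ] ∑[ u < n ] ∑[ c' < n ] 𝟙 (codePair? u c c' ×-dec (codeDegree u ≟ 2))
      ≡⟨ sum-cong-≗ (λ c → ∑-comm (λ u c' → 𝟙 (codePair? u c c' ×-dec (codeDegree u ≟ 2)))) ⟩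
    ∑[ c < n ] ∑[ c' < n ] ∑[ u < n ] 𝟙 (codePair? u c c' ×-dec (codeDegree u ≟ 2)) ∎
    where
    open ≡-Reasoning
    e₂ : Fin n → ℕ
    e₂ u = 𝟙 (codeDegree u ≟ 2)
    spread : ∀ u → codePairs u * e₂ u ≡ ∑[ c < n ] ∑[ c' < n ] 𝟙 (codePair? u c c' ×-dec (codeDegree u ≟ 2))
    spread u = begin
      codePairs u * e₂ u
        ≡⟨ *-distribʳ-sum (e₂ u) (λ c → ∑[ c' < n ] 𝟙 (codePair? u c c')) ⟩
      ∑[ c < n ] (∑[ c' < n ] 𝟙 (codePair? u c c') * e₂ u)
        ≡⟨ sum-cong-≗ (λ c → *-distribʳ-sum (e₂ u) (λ c' → 𝟙 (codePair? u c c'))) ⟩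
      ∑[ c < n ] ∑[ c' < n ] (𝟙 (codePair? u c c') * e₂ u)
        ≡⟨ sum-cong-≗ (λ c → sum-cong-≗ (λ c' → sym (𝟙-×-dec (codePair? u c c') (codeDegree u ≟ 2)))) ⟩
      ∑[ c < n ] ∑[ c' < n ] 𝟙 (codePair? u c c' ×-dec (codeDegree u ≟ 2)) ∎

  2*#codeDegree2+#C≤#C² : 2 * #codeDegree 2 + #C ≤ #C * #C
  2*#codeDegree2+#C≤#C² = begin
    2 * #codeDegree 2 + #C
      ≡⟨ cong (_+ #C) 2*#codeDegree2≡∑codePairs ⟩
    ∑[ c < n ] ∑[ c' < n ] ∑[ u < n ] 𝟙 (codePair? u c c' ×-dec (codeDegree u ≟ 2)) + #C
      ≤⟨ +-monoˡ-≤ #C (∑-mono n (λ c → ∑-mono n (λ c' → ∑-unique-𝟙 n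
           (λ u → codePair? u c c' ×-dec (codeDegree u ≟ 2)) (codeword-pair? c c')
           (λ _ (((c∈C , _) , (c'∈C , _) , c≢c') , _) → c∈C , c'∈C , c≢c')
           (codeDegree≡2-injective c c')))) ⟩
    ∑[ c < n ] ∑[ c' < n ] 𝟙 (codeword-pair? c c') + #C
      ≡⟨ ∑-𝟙-distinct-pairs n (_∈? C) ⟩
    #C * #C ∎
    where
    open ≤-Reasoning
    codeword-pair? : ∀ c c' → Dec (c ∈ C × c' ∈ C × c ≢ c')
    codeword-pair? c c' = (c ∈? C) ×-dec ((c' ∈? C) ×-dec ¬? (c ≟ᶠ c'))

  3*n≤∑codeDegree+2*#codeDegree1+#codeDegree2 :
    3 * n ≤ ∑[ u < n ] codeDegree u + 2 * #codeDegree 1 + #codeDegree 2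
  3*n≤∑codeDegree+2*#codeDegree1+#codeDegree2 = begin
    3 * n                                        ≡⟨ trans (*-comm 3 n) (sym (∑-const n 3)) ⟩
    ∑[ u < n ] 3                                 ≤⟨ ∑-mono n (λ u → 3≤m+2*[m≡1]+[m≡2] (codeDegree≥1 u)) ⟩
    ∑[ u < n ] (codeDegree u + 2 * e₁ u + e₂ u)  ≡⟨ ∑-distrib-+ (λ u → codeDegree u + 2 * e₁ u) e₂ ⟩
    ∑[ u < n ] (codeDegree u + 2 * e₁ u) + #codeDegree 2
      ≡⟨ cong (_+ #codeDegree 2) (trans (∑-distrib-+ codeDegree (λ u → 2 * e₁ u))
                                       (cong (∑[ u < n ] codeDegree u +_) (sym (*-distribˡ-sum 2 e₁)))) ⟩
    ∑[ u < n ] codeDegree u + 2 * #codeDegree 1 + #codeDegree 2 ∎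
    where
    open ≤-Reasoning
    e₁ e₂ : Fin n → ℕ
    e₁ u = 𝟙 (codeDegree u ≟ 1)
    e₂ u = 𝟙 (codeDegree u ≟ 2)

  identifyingCode-size : ∀ K → (∀ c → ∑[ u < n ] 𝟙 (adj? u c) ≤ K) →
                         6 * n + ∣ C ∣ ≤ ∣ C ∣ * (2 * K + 4 + ∣ C ∣)
  identifyingCode-size K nbhd≤K rewrite ∣p∣≡∑𝟙∈ C =
    double-counting-inequality {n = n} (∑codeDegree≤#C*K K nbhd≤K)
      3*n≤∑codeDegree+2*#codeDegree1+#codeDegree2 #codeDegree1≤#C 2*#codeDegree2+#C≤#C²

module GQCounting {s t : ℕ} (G : GQ s t) where
  open GQ G

  adj? : ∀ u v → Dec (InClosedNbhd G u v)
  adj? u v = (v ≟ᶠ u) ⊎-dec any? (λ L → (u ∈? line L) ×-dec (v ∈? line L))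

  ∑-line : ∀ L → ∑[ x < nP ] 𝟙 (x ∈? line L) ≡ suc s
  ∑-line L = trans (sym (∣p∣≡∑𝟙∈ (line L))) (lineSize L)

  ∑-lines-through : ∀ x → ∑[ L < nL ] 𝟙 (x ∈? line L) ≡ suc t
  ∑-lines-through x = begin
    ∑[ L < nL ] 𝟙 (x ∈? line L)                   ≡⟨ sum-cong-≗ (λ L → 𝟙∈≡𝟙lookup x (line L)) ⟩
    ∑[ L < nL ] 𝟙 (lookup (line L) x ≟ᵇ inside)   ≡⟨ sym (∣tabulate∣≡∑𝟙 nL (λ L → lookup (line L) x)) ⟩
    ∣ tabulate (λ L → lookup (line L) x) ∣        ≡⟨ pointDeg x ⟩
    suc t                                         ∎
    where open ≡-Reasoning

  others-on-line : ∀ L c → c ∈ line L → ∑[ u < nP ] (𝟙 (u ∈? line L) * 𝟙 (¬? (c ≟ᶠ u))) ≡ s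
  others-on-line L c c∈L = suc-injective (begin
    1 + ∑[ u < nP ] (𝟙 (u ∈? line L) * 𝟙 (¬? (c ≟ᶠ u)))
      ≡⟨ cong (_+ ∑[ u < nP ] (𝟙 (u ∈? line L) * 𝟙 (¬? (c ≟ᶠ u)))) (sym (𝟙-yes c∈L (c ∈? line L))) ⟩
    𝟙 (c ∈? line L) + ∑[ u < nP ] (𝟙 (u ∈? line L) * 𝟙 (¬? (c ≟ᶠ u)))
      ≡⟨ sym (∑-pick nP (λ u → 𝟙 (u ∈? line L)) c) ⟩
    ∑[ u < nP ] 𝟙 (u ∈? line L)
      ≡⟨ ∑-line L ⟩
    suc s ∎)
    where open ≡-Reasoning

  closedNbhd-size : ∀ c → ∑[ u < nP ] 𝟙 (adj? u c) ≤ 1 + suc t * s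
  closedNbhd-size c = begin
    ∑[ u < nP ] 𝟙 (adj? u c)
      ≤⟨ ∑-mono nP (λ u → adj≤ u (adj? u c) (c ≟ᶠ u)) ⟩
    ∑[ u < nP ] (𝟙 (c ≟ᶠ u) + ∑[ L < nL ] (𝟙 (c ∈? line L) * other L u))
      ≡⟨ ∑-distrib-+ (λ u → 𝟙 (c ≟ᶠ u)) (λ u → ∑[ L < nL ] (𝟙 (c ∈? line L) * other L u)) ⟩
    ∑[ u < nP ] 𝟙 (c ≟ᶠ u) + ∑[ u < nP ] ∑[ L < nL ] (𝟙 (c ∈? line L) * other L u)
      ≡⟨ cong₂ _+_ (∑-𝟙≡ nP c) (∑-comm (λ u L → 𝟙 (c ∈? line L) * other L u)) ⟩
    1 + ∑[ L < nL ] ∑[ u < nP ] (𝟙 (c ∈? line L) * other L u)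
      ≡⟨ cong suc (sum-cong-≗ (λ L → trans (sym (*-distribˡ-sum (𝟙 (c ∈? line L)) (other L)))
                                           (𝟙*-cong (others-on-line L c) (c ∈? line L)))) ⟩
    1 + ∑[ L < nL ] (𝟙 (c ∈? line L) * s)
      ≡⟨ cong suc (sym (*-distribʳ-sum s (λ L → 𝟙 (c ∈? line L)))) ⟩
    1 + ∑[ L < nL ] 𝟙 (c ∈? line L) * s
      ≡⟨ cong (λ k → 1 + k * s) (∑-lines-through c) ⟩
    1 + suc t * s ∎
    where
    open ≤-Reasoning
    other : Fin nL → Fin nP → ℕ
    other L u = 𝟙 (u ∈? line L) * 𝟙 (¬? (c ≟ᶠ u))
    adj≤ : ∀ u (a : Dec (InClosedNbhd G u c)) (e : Dec (c ≡ u)) →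
           𝟙 a ≤ 𝟙 e + ∑[ L < nL ] (𝟙 (c ∈? line L) * (𝟙 (u ∈? line L) * 𝟙 (¬? e)))
    adj≤ u (no _)                          _         = z≤n
    adj≤ u (yes _)                         (yes _)   = s≤s z≤n
    adj≤ u (yes (inj₁ c≡u))                (no c≢u)  = ⊥-elim (c≢u c≡u)
    adj≤ u (yes (inj₂ (L , u∈L , c∈L)))    (no c≢u)  =
      subst (_≤ ∑[ M < nL ] (𝟙 (c ∈? line M) * (𝟙 (u ∈? line M) * 1)))
            (cong₂ _*_ (𝟙-yes c∈L (c ∈? line L)) (cong (_* 1) (𝟙-yes u∈L (u ∈? line L))))
            (term≤∑ nL (λ M → 𝟙 (c ∈? line M) * (𝟙 (u ∈? line M) * 1)) L)

  Meets : Fin nL → Fin nL → Set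
  Meets M L = ∃[ R ] (R ∈ line M × R ∈ line L)

  meets? : ∀ M L → Dec (Meets M L)
  meets? M L = any? (λ R → (R ∈? line M) ×-dec (R ∈? line L))

  module _ (L : Fin nL) where

    Transversal : Fin nL → Set
    Transversal M = Meets M L × M ≢ L

    transversal? : ∀ M → Dec (Transversal M)
    transversal? M = meets? M L ×-dec ¬? (M ≟ᶠ L)

    meet-unique : ∀ {M} → M ≢ L → ∀ x y → x ∈ line M × x ∈ line L → y ∈ line M × y ∈ line L → x ≡ y
    meet-unique {M} M≢L x y (x∈M , x∈L) (y∈M , y∈L) with x ≟ᶠ y
    ... | yes x≡y = x≡y
    ... | no  x≢y = ⊥-elim (M≢L (partialLinear x y M L x≢y x∈M y∈M x∈L y∈L))

    points-off : ∀ M → M ≢ L → s ≤ ∑[ x < nP ] 𝟙 ((x ∈? line M) ×-dec ¬? (x ∈? line L))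
    points-off M M≢L = ∑-𝟙-all-but-one nP (λ x → x ∈? line M) (λ x → x ∈? line L) (∑-line M)
      (∑-unique-𝟙 nP (λ x → (x ∈? line M) ×-dec (x ∈? line L)) (yes tt) (λ _ _ → tt) (meet-unique M≢L))

    other-lines-through : ∀ R → t ≤ ∑[ M < nL ] 𝟙 ((R ∈? line M) ×-dec ¬? (M ≟ᶠ L))
    other-lines-through R = ∑-𝟙-all-but-one nL (λ M → R ∈? line M) (_≟ᶠ L) (∑-lines-through R)
      (∑-unique-𝟙 nL (λ M → (R ∈? line M) ×-dec (M ≟ᶠ L)) (yes tt) (λ _ _ → tt)
                  (λ M M' (_ , M≡L) (_ , M'≡L) → trans M≡L (sym M'≡L)))

    #transversals≥ : suc s * t ≤ ∑[ M < nL ] 𝟙 (transversal? M)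
    #transversals≥ = begin
      suc s * t
        ≡⟨ cong (_* t) (sym (∑-line L)) ⟩
      ∑[ R < nP ] 𝟙 (R ∈? line L) * t
        ≡⟨ *-distribʳ-sum t (λ R → 𝟙 (R ∈? line L)) ⟩
      ∑[ R < nP ] (𝟙 (R ∈? line L) * t)
        ≤⟨ ∑-mono nP (λ R → 𝟙*-≤ (λ R∈L → ≤-trans (other-lines-through R)
                                  (∑-mono nL (λ M → 𝟙-mono (λ (R∈M , M≢L) → (R∈M , R∈L) , M≢L)
                                                   ((R ∈? line M) ×-dec ¬? (M ≟ᶠ L)) (crossing? R M))))
                                (R ∈? line L)) ⟩
      ∑[ R < nP ] ∑[ M < nL ] 𝟙 (crossing? R M)
        ≡⟨ ∑-comm (λ R M → 𝟙 (crossing? R M)) ⟩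
      ∑[ M < nL ] ∑[ R < nP ] 𝟙 (crossing? R M)
        ≤⟨ ∑-mono nL (λ M → ∑-unique-𝟙 nP (λ R → crossing? R M) (transversal? M)
                              (λ R (R∈M∩L , M≢L) → (R , R∈M∩L) , M≢L)
                              (λ x y (x∈M∩L , M≢L) (y∈M∩L , _) → meet-unique M≢L x y x∈M∩L y∈M∩L)) ⟩
      ∑[ M < nL ] 𝟙 (transversal? M) ∎
      where
      open ≤-Reasoning
      crossing? : ∀ R M → Dec ((R ∈ line M × R ∈ line L) × M ≢ L)
      crossing? R M = ((R ∈? line M) ×-dec (R ∈? line L)) ×-dec ¬? (M ≟ᶠ L)

    s*#transversals≤#off : s * ∑[ M < nL ] 𝟙 (transversal? M) ≤ ∑[ x < nP ] 𝟙 (¬? (x ∈? line L))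
    s*#transversals≤#off = begin
      s * ∑[ M < nL ] 𝟙 (transversal? M)
        ≡⟨ trans (*-comm s _) (*-distribʳ-sum s (λ M → 𝟙 (transversal? M))) ⟩
      ∑[ M < nL ] (𝟙 (transversal? M) * s)
        ≤⟨ ∑-mono nL (λ M → 𝟙*-≤ (λ tr → ≤-trans (points-off M (proj₂ tr))
                                  (∑-mono nP (λ x → 𝟙-mono (λ off → off , tr)
                                                   ((x ∈? line M) ×-dec ¬? (x ∈? line L)) (off-on? x M))))
                                (transversal? M)) ⟩
      ∑[ M < nL ] ∑[ x < nP ] 𝟙 (off-on? x M)
        ≡⟨ ∑-comm (λ M x → 𝟙 (off-on? x M)) ⟩
      ∑[ x < nP ] ∑[ M < nL ] 𝟙 (off-on? x M)
        ≤⟨ ∑-mono nP (λ x → ∑-unique-𝟙 nL (off-on? x) (¬? (x ∈? line L))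
                              (λ _ ((_ , x∉L) , _) → x∉L) (one-transversal x)) ⟩
      ∑[ x < nP ] 𝟙 (¬? (x ∈? line L)) ∎
      where
      open ≤-Reasoning
      off-on? : ∀ x M → Dec ((x ∈ line M × x ∉ line L) × Transversal M)
      off-on? x M = ((x ∈? line M) ×-dec ¬? (x ∈? line L)) ×-dec transversal? M
      one-transversal : ∀ x M M' → (x ∈ line M × x ∉ line L) × Transversal M →
                        (x ∈ line M' × x ∉ line L) × Transversal M' → M ≡ M'
      one-transversal x M M' ((x∈M , x∉L) , meetsM , _) ((x∈M' , _) , meetsM' , _) =
        let (_ , _ , unique) = gqAxiom x L x∉L in trans (unique M x∈M meetsM) (sym (unique M' x∈M' meetsM'))

    #on+#off : suc s + ∑[ x < nP ] 𝟙 (¬? (x ∈? line L)) ≡ nP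
    #on+#off = begin
      suc s + ∑[ x < nP ] 𝟙 (¬? (x ∈? line L))
        ≡⟨ cong (_+ ∑[ x < nP ] 𝟙 (¬? (x ∈? line L))) (sym (∑-line L)) ⟩
      ∑[ x < nP ] 𝟙 (x ∈? line L) + ∑[ x < nP ] 𝟙 (¬? (x ∈? line L))
        ≡⟨ sym (∑-distrib-+ (λ x → 𝟙 (x ∈? line L)) (λ x → 𝟙 (¬? (x ∈? line L)))) ⟩
      ∑[ x < nP ] (𝟙 (x ∈? line L) + 𝟙 (¬? (x ∈? line L)))
        ≡⟨ sum-cong-≗ (λ x → 𝟙+𝟙¬ (x ∈? line L)) ⟩
      ∑[ x < nP ] 1
        ≡⟨ trans (∑-const nP 1) (*-identityʳ nP) ⟩
      nP ∎
      where open ≡-Reasoning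

  #points≥ : suc s * suc (s * t) ≤ nP
  #points≥ = begin
    suc s * suc (s * t)                           ≡⟨ solve (s ∷ t ∷ []) ⟩
    suc s + s * (suc s * t)                       ≤⟨ +-monoʳ-≤ (suc s) (*-monoʳ-≤ s (#transversals≥ L₀)) ⟩
    suc s + s * ∑[ M < nL ] 𝟙 (transversal? L₀ M) ≤⟨ +-monoʳ-≤ (suc s) (s*#transversals≤#off L₀) ⟩
    suc s + ∑[ x < nP ] 𝟙 (¬? (x ∈? line L₀))     ≡⟨ #on+#off L₀ ⟩
    nP ∎
    where
    open ≤-Reasoning
    L₀ : Fin nL
    L₀ = nonzero-∑⇒Fin nL _ (∑-lines-through (fromℕ< nonempty))

code-size-arithmetic : ∀ q c n → suc q * suc (q * q) ≤ n →
                       6 * n + c ≤ c * (2 * (1 + suc q * q) + 4 + c) → 3 * q ∸ 4 ≤ c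
code-size-arithmetic q c n n≥ 6n+c≤ with 3 * q ∸ 4 ≤? c
... | yes c≥ = c≥
... | no  c≱ = ⊥-elim (<⇒≱ too-big fits)
  -- With c + 5 ≤ 3q the hypotheses give 6n + c + 5Y ≤ (c + 5)Y ≤ 3qY, whereas
  -- 6(q+1)(q²+1) + c + 5Y exceeds 3qY by q² + 28q + c + 11.
  where
  open ≤-Reasoning
  c<3q∸4 : c < 3 * q ∸ 4
  c<3q∸4 = ≰⇒> c≱
  4≤3q : 4 ≤ 3 * q
  4≤3q = <⇒≤ (m∸n≢0⇒n<m (λ 3q∸4≡0 → n≮0 (subst (c <_) 3q∸4≡0 c<3q∸4)))
  c+5≤3q : c + 5 ≤ 3 * q
  c+5≤3q = subst (_≤ 3 * q) (sym (+-suc c 4)) (m≤o∸n⇒m+n≤o (suc c) 4≤3q c<3q∸4)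
  Y : ℕ
  Y = 2 * (q * q) + 5 * q + 1
  X≤Y : 2 * (1 + suc q * q) + 4 + c ≤ Y
  X≤Y = +-cancelʳ-≤ 5 _ _ (begin
    2 * (1 + suc q * q) + 4 + c + 5    ≡⟨ solve (q ∷ c ∷ []) ⟩
    2 * (q * q) + 2 * q + 6 + (c + 5)  ≤⟨ +-monoʳ-≤ (2 * (q * q) + 2 * q + 6) c+5≤3q ⟩
    2 * (q * q) + 2 * q + 6 + 3 * q    ≡⟨ solve (q ∷ []) ⟩
    2 * (q * q) + 5 * q + 1 + 5        ∎)
  fits : 6 * n + c + 5 * Y ≤ 3 * q * Y
  fits = begin
    6 * n + c + 5 * Y                         ≤⟨ +-monoˡ-≤ (5 * Y) 6n+c≤ ⟩
    c * (2 * (1 + suc q * q) + 4 + c) + 5 * Y ≤⟨ +-monoˡ-≤ (5 * Y) (*-monoʳ-≤ c X≤Y) ⟩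
    c * Y + 5 * Y                             ≡⟨ sym (*-distribʳ-+ Y c 5) ⟩
    (c + 5) * Y                               ≤⟨ *-monoˡ-≤ Y c+5≤3q ⟩
    3 * q * Y                                 ∎
  too-big : 3 * q * Y < 6 * n + c + 5 * Y
  too-big = begin-strict
    3 * q * Y                                   <⟨ m<m+n (3 * q * Y) (s≤s z≤n) ⟩
    3 * q * (2 * (q * q) + 5 * q + 1) + suc (q * q + 28 * q + 10 + c)
      ≡⟨ solve (q ∷ c ∷ []) ⟩
    6 * (suc q * suc (q * q)) + c + 5 * (2 * (q * q) + 5 * q + 1)
      ≤⟨ +-monoˡ-≤ (5 * Y) (+-monoˡ-≤ c (*-monoʳ-≤ 6 n≥)) ⟩
    6 * n + c + 5 * Y                           ∎

proposition4p21 : (q : ℕ) → IsPrimePower q → (G : GQ q q) → (C : Subset (GQ.nP G)) →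
                  IsIdentifyingCode G C → 3 * q ∸ 4 ≤ ∣ C ∣
proposition4p21 q _ G C (dominating , separating) =
  code-size-arithmetic q ∣ C ∣ nP #points≥ (identifyingCode-size (1 + suc q * q) closedNbhd-size)
  where
  open GQ G using (nP)
  open GQCounting G
  open IdentifyingCodeCounting (InClosedNbhd G) adj? C dominating separating
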